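{- Let $S=\{i_1,i_2,\dots,i_s\}$ be $n$-admissible. Then $\#\widehat{P}_B(S,n)$ is even if $S$ contains some even number or if $n$ is odd, and $\#\widehat{P}_B(S,n)$ is odd otherwise (i.e. when all elements of $S$ are odd and $n$ is even).
   Context: $B_n$ is the set of signed permutations $\pi=\pi_1\cdots\pi_n$: words with each $\pi_i\in\{ -n,\dots,-1,1,\dots,n\}$ and $\{|\pi_1|,\dots,|\pi_n|\}=\{1,\dots,n\}$. Set $\pi_0=0$. An index $i\in\{1,\dots,n-1\}$ is a peak of $\pi$ if $\pi_{i-1}<\pi_i>\pi_{i+1}$. $\widehat{P}_B(S,n)$ is the set of $\pi\in B_n$ whose peak set (in this sense) equals $S$. $S$ is $n$-admissible if $\widehat{P}_B(S,n)\neq\emptyset$. -}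

module Defs where

open import Data.Nat using (ℕ; zero; suc; _≤_; _<?_; _%_; _∸_)
open import Data.Integer as ℤ using (ℤ; ∣_∣) renaming (_<_ to _<ℤ_)
open import Data.Fin using (Fin; fromℕ<)
open import Data.Vec using (Vec; lookup)
open import Data.List using (List; length)
open import Data.List.Membership.Propositional using (_∈_)
open import Data.List.Relation.Unary.Unique.Propositional using (Unique)
open import Data.Product using (Σ; ∃; ∃-syntax; _×_)
open import Relation.Nullary using (yes; no)
open import Relation.Binary.PropositionalEquality using (_≡_)
open import Function.Bundles using (_⇔_)

-- A signed permutation of length n is a word π₁⋯πₙ (a Vec ℤ n) with every
-- πᵢ ∈ {-n,…,-1,1,…,n} and {|π₁|,…,|πₙ|} = {1,…,n}.
IsSignedPerm : (n : ℕ) → Vec ℤ n → Set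
IsSignedPerm n π =
  (∀ (j : Fin n) → 1 ≤ ∣ lookup π j ∣ × ∣ lookup π j ∣ ≤ n)
  × (∀ (m : ℕ) → 1 ≤ m → m ≤ n → ∃[ j ] ∣ lookup π j ∣ ≡ m)

-- 1-based entries with the convention π₀ = 0 (and value 0 beyond n, never used
-- for peaks since peaks satisfy i ≤ n-1).
entry : {n : ℕ} → Vec ℤ n → ℕ → ℤ
entry π zero = ℤ.0ℤ
entry {n} π (suc i) with i <? n
... | yes i<n = lookup π (fromℕ< i<n)
... | no _ = ℤ.0ℤ

IsPeak : (n : ℕ) → Vec ℤ n → ℕ → Set
IsPeak n π i =
  1 ≤ i × i ≤ n ∸ 1 × entry π (i ∸ 1) <ℤ entry π i × entry π (suc i) <ℤ entry π i

-- The peak set of π equals S (S given as a finite list of naturals; only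
-- membership matters).
PeakSetIs : (n : ℕ) → Vec ℤ n → List ℕ → Set
PeakSetIs n π S = ∀ (i : ℕ) → (IsPeak n π i ⇔ i ∈ S)

-- π ∈ P̂_B(S,n)
InPB : List ℕ → (n : ℕ) → Vec ℤ n → Set
InPB S n π = IsSignedPerm n π × PeakSetIs n π S

Admissible : List ℕ → ℕ → Set
Admissible S n = ∃[ π ] InPB S n π

HasCard : {A : Set} → (A → Set) → ℕ → Set
HasCard {A} P k =
  Σ (List A) λ xs → Unique xs × (∀ x → (x ∈ xs ⇔ P x)) × length xs ≡ k

IsEven IsOdd : ℕ → Set
IsEven m = m % 2 ≡ 0
IsOdd m = m % 2 ≡ 1

module Submission where

-- Call position i of a signed permutation π canonical when π has there the
-- shape  π_i = -i  (i even),  resp.  π_i = ±i  and  π_{i+1} < 0  (i odd, i < n).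
-- Negating the value m, where m is the first non-canonical position, defines
-- a sign-reversing involution φ on P̂_B(S,n): the entry ±m only meets
-- neighbours of larger absolute value (or a configuration that is a peak
-- neither before nor after), so peaks are preserved, and m stays the first
-- non-canonical position, so φ is an involution.  Its fixed points are the
-- canonical words, which exist only for n even, have no peaks at even
-- positions, and are determined by their peak set.  Since the non-fixed
-- members of P̂_B(S,n) pair up, #P̂_B(S,n) ≡ #(fixed points) (mod 2), which is
-- 0 if S has an even element or n is odd, and 1 otherwise.

open import Defs
open import Data.Nat using (ℕ)
open import Data.List using (List)
open import Data.List.Relation.Unary.Any using (Any)
open import Data.List.Relation.Unary.All using (All)
open import Data.Product using (∃-syntax; _×_)
open import Data.Sum using (_⊎_)

open import Data.Bool using (Bool; true; false; not; if_then_else_)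
open import Data.Bool.Properties using (not-injective)
open import Data.Maybe using (Maybe; just; nothing)
open import Data.Nat as ℕ using (zero; suc; _+_; _*_; _∸_; _≤_; _<_; z≤n; s≤s; _%_; _≤?_; _<?_)
  renaming (_≟_ to _≟ℕ_)
import Data.Nat.Properties as ℕP
open import Data.Nat.DivMod using ([m+kn]%n≡m%n)
open import Data.Integer using (ℤ; +_; -[1+_]; -_; +<+; -<+; -<-; 0ℤ; ∣_∣)
  renaming (_<_ to _<ℤ_; _<?_ to _<ℤ?_; _≟_ to _≟ℤ_)
open import Data.Integer.Properties using (neg-involutive; ∣-i∣≡∣i∣)
open import Data.Fin as Fin using (Fin; toℕ; fromℕ<; punchOut)
import Data.Fin.Properties as FinP
open import Data.Vec using (Vec; []; _∷_; lookup; map; tabulate)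
open import Data.Vec.Properties
  using (lookup-map; map-∘; map-cong; map-id; tabulate∘lookup; tabulate-cong; lookup∘tabulate; ≡-dec)
open import Data.List as List using ([]; _∷_; length; filter; concatMap; deduplicate)
open import Data.List.Properties using (filter-accept; filter-reject; filter-all; filter-none)
open import Data.List.Membership.Propositional using (_∈_; find)
open import Data.List.Membership.Propositional.Properties
  using (∈-concatMap⁺; ∈-map⁺; ∈-filter⁺; ∈-filter⁻; ∈-deduplicate⁺; ∈-deduplicate⁻)
open import Data.List.Membership.DecPropositional ℕP._≟_ using (_∈?_)
open import Data.List.Relation.Unary.Any as Any using (here; there)
open import Data.List.Relation.Unary.All as All using ([]; _∷_)
open import Data.List.Relation.Unary.AllPairs using ([]; _∷_)
open import Data.List.Relation.Unary.Unique.Propositional using (Unique)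
import Data.List.Relation.Unary.Unique.Propositional.Properties as Unique
import Data.List.Relation.Unary.Unique.DecPropositional.Properties as UniqueDec
open import Data.Product using (∃; _,_; proj₁; proj₂; uncurry)
open import Data.Sum using (inj₁; inj₂)
open import Data.Empty using (⊥; ⊥-elim)
open import Function.Base using (_∘_; id)
open import Function.Bundles using (_⇔_; mk⇔; Equivalence)
import Function.Properties.Equivalence as ⇔
open import Relation.Nullary using (¬_; Dec; yes; no; ¬?)
open import Relation.Nullary.Decidable using (_×-dec_; _→-dec_; map′)
open import Relation.Unary using (Decidable; ∁)
open import Relation.Unary.Properties using (∁?)
open import Relation.Binary.Definitions using (DecidableEquality; tri<; tri≈; tri>)
open import Relation.Binary.PropositionalEquality

-- Negating the entry of smaller absolute value does not change the outcome of
-- a comparison; this is why flipping one sign in a signed permutation only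
-- affects comparisons with entries of smaller absolute value.
neg-smaller-<ˡ : ∀ x y → ∣ x ∣ < ∣ y ∣ → x <ℤ y → - x <ℤ y
neg-smaller-<ˡ (+ zero)    (+ b)     _ (+<+ p) = +<+ p
neg-smaller-<ˡ (+ suc a)   (+ b)     _ (+<+ p) = -<+
neg-smaller-<ˡ -[1+ a ]    (+ b)     h -<+     = +<+ h
neg-smaller-<ˡ -[1+ a ]    -[1+ b ]  h (-<- p) = ⊥-elim (ℕP.<-asym (ℕ.s<s⁻¹ h) p)

neg-smaller-<ʳ : ∀ x y → ∣ x ∣ < ∣ y ∣ → y <ℤ x → y <ℤ - x
neg-smaller-<ʳ (+ a)       (+ b)     h (+<+ p) = ⊥-elim (ℕP.<-asym h p)
neg-smaller-<ʳ (+ zero)    -[1+ b ]  _ -<+     = -<+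
neg-smaller-<ʳ (+ suc a)   -[1+ b ]  h -<+     = -<- (ℕ.s<s⁻¹ h)
neg-smaller-<ʳ -[1+ a ]    -[1+ b ]  _ (-<- p) = -<+

smaller-<ˡ-⇔ : ∀ x y → ∣ x ∣ < ∣ y ∣ → (x <ℤ y) ⇔ (- x <ℤ y)
smaller-<ˡ-⇔ x y h = mk⇔ (neg-smaller-<ˡ x y h)
  (λ p → subst (_<ℤ y) (neg-involutive x)
           (neg-smaller-<ˡ (- x) y (subst (_< ∣ y ∣) (sym (∣-i∣≡∣i∣ x)) h) p))

smaller-<ʳ-⇔ : ∀ x y → ∣ x ∣ < ∣ y ∣ → (y <ℤ x) ⇔ (y <ℤ - x)
smaller-<ʳ-⇔ x y h = mk⇔ (neg-smaller-<ʳ x y h)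
  (λ p → subst (y <ℤ_) (neg-involutive x)
           (neg-smaller-<ʳ (- x) y (subst (_< ∣ y ∣) (sym (∣-i∣≡∣i∣ x)) h) p))

not-below-neg : ∀ x k → ∣ x ∣ < k → ¬ (x <ℤ - (+ k))
not-below-neg (+ a)     (suc k) _ ()
not-below-neg -[1+ a ]  (suc k) h (-<- p) = ℕP.<-asym (ℕ.s<s⁻¹ h) p

nonneg-not-below-smaller : ∀ x y → ¬ (y <ℤ 0ℤ) → ∣ x ∣ < ∣ y ∣ → ¬ (y <ℤ x)
nonneg-not-below-smaller x     -[1+ b ] y≮0 _ _       = y≮0 -<+
nonneg-not-below-smaller (+ a) (+ b)    _   h (+<+ p) = ℕP.<-asym h p

negative-of-abs : ∀ x {m} → x <ℤ 0ℤ → ∣ x ∣ ≡ m → x ≡ - (+ m)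
negative-of-abs -[1+ a ] -<+ refl = refl

neg-not-positive : ∀ k → ¬ (0ℤ <ℤ - (+ k))
neg-not-positive zero    (+<+ ())
neg-not-positive (suc k) ()

same-abs-same-sign : ∀ x y → ∣ x ∣ ≡ ∣ y ∣ → (0ℤ <ℤ x ⇔ 0ℤ <ℤ y) → x ≡ y
same-abs-same-sign (+ a)    (+ b)    a≡b _ = cong +_ a≡b
same-abs-same-sign -[1+ a ] -[1+ b ] a≡b _ = cong -[1+_] (ℕP.suc-injective a≡b)
same-abs-same-sign (+ a)    -[1+ b ] refl sign with Equivalence.to sign (+<+ (s≤s z≤n))
... | ()
same-abs-same-sign -[1+ a ] (+ b)    refl sign with Equivalence.from sign (+<+ (s≤s z≤n))
... | ()

below-abs : ∀ x {k} → ∣ x ∣ < k → x <ℤ + k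
below-abs (+ a)    h = +<+ h
below-abs -[1+ a ] _ = -<+

neg-fixed⇒abs-zero : ∀ x → - x ≡ x → ∣ x ∣ ≡ 0
neg-fixed⇒abs-zero (+ zero)  _  = refl
neg-fixed⇒abs-zero (+ suc a) ()
neg-fixed⇒abs-zero -[1+ a ]  ()

length-filter-split : ∀ {A : Set} {P : A → Set} (P? : Decidable P) xs →
  length xs ≡ length (filter P? xs) + length (filter (∁? P?) xs)
length-filter-split P? [] = refl
length-filter-split P? (x ∷ xs) with P? x
... | yes _ = cong suc (length-filter-split P? xs)
... | no _ = trans (cong suc (length-filter-split P? xs)) (sym (ℕP.+-suc _ _))

-- Parity of an involution: a duplicate-free list on which φ acts as an
-- involution has the same length parity as its set of φ-fixed points, since
-- the remaining elements split into 2-element orbits {x, φ x}.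
module InvolutionParity {A : Set} (_≟_ : DecidableEquality A) (φ : A → A) where

  Fixed : A → Set
  Fixed x = φ x ≡ x

  fixed? : Decidable Fixed
  fixed? x = φ x ≟ x

  Closed : List A → Set
  Closed xs = ∀ {x} → x ∈ xs → φ x ∈ xs

  Involutive : List A → Set
  Involutive xs = ∀ {x} → x ∈ xs → φ (φ x) ≡ x

  without : A → List A → List A
  without a = filter (λ y → ¬? (y ≟ a))

  length-without : ∀ {a xs} → Unique xs → a ∈ xs → length xs ≡ suc (length (without a xs))
  length-without {a} {x ∷ xs} (x∉xs ∷ _) (here refl)
    rewrite filter-reject (λ y → ¬? (y ≟ a)) {xs = xs} (λ x≢x → x≢x refl)
          | filter-all (λ y → ¬? (y ≟ a)) (All.map (λ x≢y y≡x → x≢y (sym y≡x)) x∉xs) = refl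
  length-without {a} {x ∷ xs} (x∉xs ∷ u) (there a∈xs)
    rewrite filter-accept (λ y → ¬? (y ≟ a)) {xs = xs} (All.lookup x∉xs a∈xs) =
    cong suc (length-without u a∈xs)

  closed-without-orbit : ∀ {x xs} → Unique (x ∷ xs) → Closed (x ∷ xs) → Involutive (x ∷ xs) →
                         Closed (without (φ x) xs)
  closed-without-orbit {x} {xs} (x∉xs ∷ _) closed invol {y} y∈ =
    ∈-filter⁺ (λ z → ¬? (z ≟ φ x)) φy∈xs φy≢φx
    where
    y∈xs = proj₁ (∈-filter⁻ (λ z → ¬? (z ≟ φ x)) {xs = xs} y∈)
    y≢φx = proj₂ (∈-filter⁻ (λ z → ¬? (z ≟ φ x)) {xs = xs} y∈)
    φy∈xs : φ y ∈ xs
    φy∈xs with closed (there y∈xs)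
    ... | here φy≡x = ⊥-elim (y≢φx (trans (sym (invol (there y∈xs))) (cong φ φy≡x)))
    ... | there φy∈ = φy∈
    φy≢φx : φ y ≢ φ x
    φy≢φx φy≡φx = All.lookup x∉xs y∈xs
      (sym (trans (sym (invol (there y∈xs))) (trans (cong φ φy≡φx) (invol (here refl)))))

  -- Without fixed points, the orbits all have two elements: the length is even.
  -- (The natural number k bounds the length and drives the recursion.)
  even-without-fixed : ∀ k xs → length xs ≤ k → Unique xs → Closed xs → Involutive xs →
                       All (∁ Fixed) xs → ∃[ t ] length xs ≡ t * 2
  even-without-fixed _ [] _ _ _ _ _ = 0 , refl
  even-without-fixed (suc k) (x ∷ xs) (s≤s len≤) (x∉xs ∷ u) closed invol (¬fx ∷ noFix) =
    let (t , eq) = even-without-fixed k rest rest≤k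
                     (Unique.filter⁺ (λ z → ¬? (z ≟ φ x)) u)
                     (closed-without-orbit (x∉xs ∷ u) closed invol)
                     (λ m → invol (there (in-xs m)))
                     (All.tabulate (λ m → All.lookup noFix (in-xs m)))
    in suc t , cong suc (trans len-xs (cong suc eq))
    where
    rest = without (φ x) xs
    in-xs : ∀ {y} → y ∈ rest → y ∈ xs
    in-xs m = proj₁ (∈-filter⁻ (λ z → ¬? (z ≟ φ x)) {xs = xs} m)
    φx∈xs : φ x ∈ xs
    φx∈xs with closed (here refl)
    ... | here φx≡x = ⊥-elim (¬fx φx≡x)
    ... | there φx∈ = φx∈
    len-xs : length xs ≡ suc (length rest)
    len-xs = length-without u φx∈xs
    rest≤k : length rest ≤ k
    rest≤k = ℕP.<⇒≤ (subst (_≤ k) len-xs len≤)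

  parity-of-fixed-points : ∀ xs → Unique xs → Closed xs → Involutive xs →
                           length xs % 2 ≡ length (filter fixed? xs) % 2
  parity-of-fixed-points xs u closed invol = begin
      length xs % 2                                      ≡⟨ cong (_% 2) (length-filter-split fixed? xs) ⟩
      (length (filter fixed? xs) + length moving) % 2    ≡⟨ cong (λ l → (length (filter fixed? xs) + l) % 2) eq ⟩
      (length (filter fixed? xs) + t * 2) % 2            ≡⟨ [m+kn]%n≡m%n (length (filter fixed? xs)) t 2 ⟩
      length (filter fixed? xs) % 2                      ∎
    where
    open ≡-Reasoning
    moving = filter (∁? fixed?) xs
    in-xs : ∀ {y} → y ∈ moving → y ∈ xs
    in-xs m = proj₁ (∈-filter⁻ (∁? fixed?) {xs = xs} m)
    not-fixed : ∀ {y} → y ∈ moving → ¬ Fixed y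
    not-fixed m = proj₂ (∈-filter⁻ (∁? fixed?) {xs = xs} m)
    moving-closed : Closed moving
    moving-closed m = ∈-filter⁺ (∁? fixed?) (closed (in-xs m))
      (λ φφy≡φy → not-fixed m (sym (trans (sym (invol (in-xs m))) φφy≡φy)))
    even = even-without-fixed (length moving) moving ℕP.≤-refl
             (Unique.filter⁺ (∁? fixed?) u) moving-closed (λ m → invol (in-xs m))
             (All.tabulate not-fixed)
    t = proj₁ even
    eq = proj₂ even

length-singleton : ∀ {A : Set} {xs : List A} {c} → Unique xs → c ∈ xs → (∀ {y} → y ∈ xs → y ≡ c) → length xs ≡ 1
length-singleton {xs = _ ∷ []}    _                  _ _    = refl
length-singleton {xs = x ∷ y ∷ _} ((x≢y All.∷ _) ∷ _) _ only = ⊥-elim (x≢y (trans (only (here refl)) (sym (only (there (here refl))))))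

ints-upTo : ℕ → List ℤ
ints-upTo zero    = + 0 ∷ []
ints-upTo (suc b) = + suc b ∷ -[1+ b ] ∷ ints-upTo b

∈-ints-upTo : ∀ b z → ∣ z ∣ ≤ b → z ∈ ints-upTo b
∈-ints-upTo zero    (+ zero)  _ = here refl
∈-ints-upTo (suc b) (+ a)     a≤ with a ≟ℕ suc b
... | yes refl = here refl
... | no a≢   = there (there (∈-ints-upTo b (+ a) (ℕ.s≤s⁻¹ (ℕP.≤∧≢⇒< a≤ a≢))))
∈-ints-upTo (suc b) -[1+ a ]  a≤ with a ≟ℕ b
... | yes refl = there (here refl)
... | no a≢   = there (there (∈-ints-upTo b -[1+ a ] (ℕ.s≤s⁻¹ (ℕP.≤∧≢⇒< a≤ (λ e → a≢ (ℕP.suc-injective e))))))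

vectors : List ℤ → (k : ℕ) → List (Vec ℤ k)
vectors r zero    = [] ∷ []
vectors r (suc k) = concatMap (λ x → List.map (x ∷_) (vectors r k)) r

∈-vectors : ∀ r k (v : Vec ℤ k) → (∀ j → lookup v j ∈ r) → v ∈ vectors r k
∈-vectors r zero    []      _ = here refl
∈-vectors r (suc k) (x ∷ v) h =
  ∈-concatMap⁺ (λ y → List.map (y ∷_) (vectors r k))
    (Any.map (λ { refl → ∈-map⁺ (x ∷_) (∈-vectors r k v (λ j → h (Fin.suc j))) }) (h Fin.zero))

-- A decidable predicate on integer vectors whose members have bounded entries
-- has a (finite) cardinality: filter the finite list of all bounded vectors.
card-of-bounded : ∀ {k} b (P : Vec ℤ k → Set) → Decidable P →
                  (∀ v → P v → ∀ j → ∣ lookup v j ∣ ≤ b) → ∃[ c ] HasCard P c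
card-of-bounded {k} b P P? bounded = length members , members , unique , membership , refl
  where
  candidates = vectors (ints-upTo b) k
  members = deduplicate (≡-dec _≟ℤ_) (filter P? candidates)
  unique = UniqueDec.deduplicate-! (≡-dec _≟ℤ_) _
  membership : ∀ v → v ∈ members ⇔ P v
  membership v = mk⇔
    (λ m → proj₂ (∈-filter⁻ P? {xs = candidates} (∈-deduplicate⁻ (≡-dec _≟ℤ_) _ m)))
    (λ p → ∈-deduplicate⁺ (≡-dec _≟ℤ_)
             (∈-filter⁺ P? (∈-vectors _ k v (λ j → ∈-ints-upTo b _ (bounded v p j))) p))

<-of-≤∸1 : ∀ {i n} → 1 ≤ i → i ≤ n ∸ 1 → i < n
<-of-≤∸1 {n = zero}  1≤i i≤0 = ⊥-elim (ℕP.<-irrefl refl (ℕP.≤-trans 1≤i i≤0))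
<-of-≤∸1 {n = suc n} _   i≤n = s≤s i≤n

peak-< : ∀ {n π i} → IsPeak n π i → i < n
peak-< (1≤i , i≤n∸1 , _) = <-of-≤∸1 1≤i i≤n∸1

_⇔-dec_ : ∀ {P Q : Set} → Dec P → Dec Q → Dec (P ⇔ Q)
P? ⇔-dec Q? = map′ (uncurry mk⇔) (λ e → Equivalence.to e , Equivalence.from e) ((P? →-dec Q?) ×-dec (Q? →-dec P?))

isSignedPerm? : ∀ n (π : Vec ℤ n) → Dec (IsSignedPerm n π)
isSignedPerm? n π =
  FinP.all? (λ j → (1 ≤? ∣ lookup π j ∣) ×-dec (∣ lookup π j ∣ ≤? n))
  ×-dec map′ (λ h m 1≤m m≤n → h (s≤s m≤n) 1≤m) (λ h {m} m<1+n 1≤m → h m 1≤m (ℕ.s≤s⁻¹ m<1+n))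
          (ℕP.allUpTo? (λ m → (1 ≤? m) →-dec FinP.any? (λ j → ∣ lookup π j ∣ ≟ℕ m)) (suc n))

isPeak? : ∀ n (π : Vec ℤ n) i → Dec (IsPeak n π i)
isPeak? n π i = (1 ≤? i) ×-dec (i ≤? n ∸ 1)
  ×-dec (entry π (i ∸ 1) <ℤ? entry π i) ×-dec (entry π (suc i) <ℤ? entry π i)

peakSetIs? : ∀ n (π : Vec ℤ n) S → Dec (PeakSetIs n π S)
peakSetIs? n π S = map′ to from
  (ℕP.allUpTo? (λ i → isPeak? n π i ⇔-dec (i ∈? S)) n ×-dec All.all? (_<? n) S)
  where
  to : (∀ {i} → i < n → (IsPeak n π i ⇔ i ∈ S)) × All (_< n) S → PeakSetIs n π S
  to (below , S<n) i = by-position (i <? n)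
    where
    by-position : Dec (i < n) → IsPeak n π i ⇔ i ∈ S
    by-position (yes i<n) = below i<n
    by-position (no  i≮n) = mk⇔ (λ pk → ⊥-elim (i≮n (peak-< pk))) (λ i∈S → ⊥-elim (i≮n (All.lookup S<n i∈S)))
  from : PeakSetIs n π S → (∀ {i} → i < n → (IsPeak n π i ⇔ i ∈ S)) × All (_< n) S
  from ps = (λ {i} _ → ps i) , All.tabulate (λ {i} i∈S → peak-< (Equivalence.from (ps i) i∈S))

inPB? : ∀ S n → Decidable (InPB S n)
inPB? S n π = isSignedPerm? n π ×-dec peakSetIs? n π S

card-PB : ∀ S n → ∃[ c ] HasCard (InPB S n) c
card-PB S n = card-of-bounded n (InPB S n) (inPB? S n) (λ π ((bounds , _) , _) j → proj₂ (bounds j))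

-- A surjective endofunction of Fin n is injective: otherwise a point outside
-- the image of a section would let Fin (suc n′) inject into Fin n′.
surjective⇒injective : ∀ {n} (f : Fin n → Fin n) → (∀ t → ∃ λ j → f j ≡ t) →
                       ∀ a b → f a ≡ f b → a ≡ b
surjective⇒injective {zero}  f surj () b fa≡fb
surjective⇒injective {suc n} f surj a b fa≡fb with a FinP.≟ b
... | yes a≡b = a≡b
... | no  a≢b = ⊥-elim (ℕP.<-irrefl refl (FinP.injective⇒≤ squeeze-injective))
  where
  section : Fin (suc n) → Fin (suc n)
  section t = proj₁ (surj t)
  f∘section : ∀ t → f (section t) ≡ t
  f∘section t = proj₂ (surj t)
  -- a and b have the same image, so at most one of them is hit by the section
  missed-by : ∀ w → f w ≡ f a → w ≢ section (f a) → ∀ t → section t ≢ w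
  missed-by w fw≡fa w≢ t st≡w =
    w≢ (trans (sym st≡w) (cong section (trans (sym (f∘section t)) (trans (cong f st≡w) fw≡fa))))
  missed : ∃ λ w → ∀ t → section t ≢ w
  missed with a FinP.≟ section (f a)
  ... | no  a≢ = a , missed-by a refl a≢
  ... | yes a≡ = b , missed-by b (sym fa≡fb) (λ b≡ → a≢b (trans a≡ (sym b≡)))
  w = proj₁ missed
  squeeze : Fin (suc n) → Fin n
  squeeze t = punchOut {i = w} (λ w≡st → proj₂ missed t (sym w≡st))
  squeeze-injective : ∀ {x y} → squeeze x ≡ squeeze y → x ≡ y
  squeeze-injective {x} {y} eq =
    trans (sym (f∘section x))
      (trans (cong f (FinP.punchOut-injective (λ q → proj₂ missed x (sym q)) (λ q → proj₂ missed y (sym q)) eq))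
             (f∘section y))

entry-< : ∀ {n} (π : Vec ℤ n) i (i<n : i < n) → entry π (suc i) ≡ lookup π (fromℕ< i<n)
entry-< {n} π i i<n with i <? n
... | yes _   = refl
... | no  i≮n = ⊥-elim (i≮n i<n)

entry-toℕ : ∀ {n} (π : Vec ℤ n) (j : Fin n) → entry π (suc (toℕ j)) ≡ lookup π j
entry-toℕ π j = trans (entry-< π (toℕ j) (FinP.toℕ<n j)) (cong (lookup π) (FinP.fromℕ<-toℕ j (FinP.toℕ<n j)))

entry-map : ∀ {n} (f : ℤ → ℤ) → f 0ℤ ≡ 0ℤ → (π : Vec ℤ n) → ∀ i → entry (map f π) i ≡ f (entry π i)
entry-map f f0 π zero = sym f0
entry-map {n} f f0 π (suc i) with i <? n
... | yes i<n = lookup-map (fromℕ< i<n) f π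
... | no  _   = sym f0

entries-determine : ∀ {n} (π π′ : Vec ℤ n) → (∀ {i} → 1 ≤ i → i ≤ n → entry π i ≡ entry π′ i) → π ≡ π′
entries-determine π π′ same = begin
  π                                   ≡⟨ tabulate∘lookup π ⟨
  tabulate (lookup π)                 ≡⟨ tabulate-cong lookup-agree ⟩
  tabulate (lookup π′)                ≡⟨ tabulate∘lookup π′ ⟩
  π′                                  ∎
  where
  open ≡-Reasoning
  lookup-agree : ∀ j → lookup π j ≡ lookup π′ j
  lookup-agree j = trans (sym (entry-toℕ π j))
    (trans (same (s≤s z≤n) (FinP.toℕ<n j)) (entry-toℕ π′ j))

record SignedPermFn (n : ℕ) (e : ℕ → ℤ) : Set where
  field
    at-zero : e 0 ≡ 0ℤ
    nonzero : ∀ {k} → 1 ≤ k → k ≤ n → 1 ≤ ∣ e k ∣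
    abs-injective : ∀ {a b} → 1 ≤ a → a ≤ n → 1 ≤ b → b ≤ n → ∣ e a ∣ ≡ ∣ e b ∣ → a ≡ b

value-position : ∀ {n π} → IsSignedPerm n π → ∀ {t} → 1 ≤ t → t ≤ n →
                 ∃ λ k → 1 ≤ k × k ≤ n × ∣ entry π k ∣ ≡ t
value-position {π = π} (_ , onto) 1≤t t≤n =
  let (j , eq) = onto _ 1≤t t≤n
  in suc (toℕ j) , s≤s z≤n , FinP.toℕ<n j , trans (cong ∣_∣ (entry-toℕ π j)) eq

-- The absolute values |π₁|,…,|πₙ| are distinct, since they cover {1,…,n}.
signedPermFn : ∀ {n π} → IsSignedPerm n π → SignedPermFn n (entry π)
signedPermFn {n} {π} (bounds , onto) = record
  { at-zero = refl
  ; nonzero = λ { {suc k} _ k<n → subst (λ z → 1 ≤ ∣ z ∣) (sym (entry-< π k k<n)) (proj₁ (bounds (fromℕ< k<n))) }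
  ; abs-injective = abs-injective
  }
  where
  -- j ↦ |π_j| - 1 is a surjection of Fin n, hence injective
  index : Fin n → Fin n
  index j = fromℕ< (shift (proj₁ (bounds j)) (proj₂ (bounds j)))
    where shift : ∀ {x} → 1 ≤ x → x ≤ n → x ∸ 1 < n
          shift {suc x} _ x<n = x<n
  toℕ-index : ∀ j → toℕ (index j) ≡ ∣ lookup π j ∣ ∸ 1
  toℕ-index j = FinP.toℕ-fromℕ< _
  index-onto : ∀ t → ∃ λ j → index j ≡ t
  index-onto t = let (j , eq) = onto (suc (toℕ t)) (s≤s z≤n) (FinP.toℕ<n t)
                 in j , FinP.toℕ-injective (trans (toℕ-index j) (cong (_∸ 1) eq))
  abs-injective : ∀ {a b} → 1 ≤ a → a ≤ n → 1 ≤ b → b ≤ n → ∣ entry π a ∣ ≡ ∣ entry π b ∣ → a ≡ b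
  abs-injective {suc a} {suc b} _ a<n _ b<n eq =
    let same-abs = trans (cong ∣_∣ (sym (entry-< π a a<n))) (trans eq (cong ∣_∣ (entry-< π b b<n)))
        same-index = FinP.toℕ-injective (trans (toℕ-index _) (trans (cong (_∸ 1) same-abs) (sym (toℕ-index _))))
    in cong suc (FinP.fromℕ<-injective a b a<n b<n (surjective⇒injective index index-onto _ _ same-index))

evenᵇ : ℕ → Bool
evenᵇ zero          = true
evenᵇ (suc zero)    = false
evenᵇ (suc (suc n)) = evenᵇ n

evenᵇ-suc : ∀ i → evenᵇ (suc i) ≡ not (evenᵇ i)
evenᵇ-suc zero          = refl
evenᵇ-suc (suc zero)    = refl
evenᵇ-suc (suc (suc i)) = evenᵇ-suc i

even-after-odd : ∀ i → evenᵇ i ≡ false → evenᵇ (suc i) ≡ true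
even-after-odd i od = trans (evenᵇ-suc i) (cong not od)

even-before-odd : ∀ i → evenᵇ (suc i) ≡ false → evenᵇ i ≡ true
even-before-odd i od = not-injective (trans (sym (evenᵇ-suc i)) od)

odd-before-even : ∀ i → evenᵇ (suc i) ≡ true → evenᵇ i ≡ false
odd-before-even i ev = not-injective (trans (sym (evenᵇ-suc i)) ev)

evenᵇ-%2 : ∀ i → i % 2 ≡ (if evenᵇ i then 0 else 1)
evenᵇ-%2 zero          = refl
evenᵇ-%2 (suc zero)    = refl
evenᵇ-%2 (suc (suc i)) = evenᵇ-%2 i

IsEven⇒evenᵇ : ∀ i → IsEven i → evenᵇ i ≡ true
IsEven⇒evenᵇ i i%2≡0 with evenᵇ i | evenᵇ-%2 i
... | true  | _       = refl
... | false | i%2≡1 = ⊥-elim (ℕP.1+n≢0 (trans (sym i%2≡1) i%2≡0))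

IsOdd⇒evenᵇ : ∀ i → IsOdd i → evenᵇ i ≡ false
IsOdd⇒evenᵇ i i%2≡1 with evenᵇ i | evenᵇ-%2 i
... | true  | i%2≡0 = ⊥-elim (ℕP.1+n≢0 (trans (sym i%2≡1) i%2≡0))
... | false | _       = refl

odd-positive : ∀ i → evenᵇ i ≡ false → 1 ≤ i
odd-positive (suc _) _ = s≤s z≤n

parity-distinct : ∀ i j → evenᵇ i ≡ false → evenᵇ j ≡ true → i ≢ j
parity-distinct i .i od ev refl with trans (sym od) ev
... | ()

odd-<-even : ∀ {i n} → i ≤ n → evenᵇ i ≡ false → evenᵇ n ≡ true → i < n
odd-<-even {i} {n} i≤n od ev = ℕP.≤∧≢⇒< i≤n (parity-distinct i n od ev)

-- Position i is canonical in e when e has there the shape of the fixed points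
-- of the involution: an even position i carries -i, an odd position i carries
-- ±i and is followed (inside the word) by a negative entry.
CanonicalShape : Bool → ℕ → (ℕ → ℤ) → ℕ → Set
CanonicalShape true  n e i = e i ≡ - (+ i)
CanonicalShape false n e i = ∣ e i ∣ ≡ i × i < n × e (suc i) <ℤ 0ℤ

Canonical : ℕ → (ℕ → ℤ) → ℕ → Set
Canonical n e i = CanonicalShape (evenᵇ i) n e i

canonical? : ∀ n e → Decidable (Canonical n e)
canonical? n e i = shape? (evenᵇ i)
  where
  shape? : ∀ b → Dec (CanonicalShape b n e i)
  shape? true  = e i ≟ℤ - (+ i)
  shape? false = (∣ e i ∣ ≟ℕ i) ×-dec (i <? n) ×-dec (e (suc i) <ℤ? 0ℤ)

canonical-even : ∀ {n e i} → evenᵇ i ≡ true → Canonical n e i ⇔ (e i ≡ - (+ i))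
canonical-even {n} {e} {i} ev = mk⇔ (subst (λ b → CanonicalShape b n e i) ev)
                                    (subst (λ b → CanonicalShape b n e i) (sym ev))

canonical-odd : ∀ {n e i} → evenᵇ i ≡ false →
                Canonical n e i ⇔ (∣ e i ∣ ≡ i × i < n × e (suc i) <ℤ 0ℤ)
canonical-odd {n} {e} {i} od = mk⇔ (subst (λ b → CanonicalShape b n e i) od)
                                   (subst (λ b → CanonicalShape b n e i) (sym od))

canonical-abs : ∀ {n e i} → Canonical n e i → ∣ e i ∣ ≡ i
canonical-abs {n} {e} {i} = by-parity (evenᵇ i)
  where
  by-parity : ∀ b → CanonicalShape b n e i → ∣ e i ∣ ≡ i
  by-parity true  c = trans (cong ∣_∣ c) (∣-i∣≡∣i∣ (+ i))
  by-parity false c = proj₁ c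

canonical-cong : ∀ {n e e′ i} → (∀ k → e k ≡ e′ k) → Canonical n e i → Canonical n e′ i
canonical-cong {n} {e} {e′} {i} same = by-parity (evenᵇ i)
  where
  by-parity : ∀ b → CanonicalShape b n e i → CanonicalShape b n e′ i
  by-parity true  c = trans (sym (same i)) c
  by-parity false (abs , i<n , next<0) =
    trans (cong ∣_∣ (sym (same i))) abs , i<n , subst (_<ℤ 0ℤ) (same (suc i)) next<0

firstFailure : ∀ {P : ℕ → Set} → Decidable P → ℕ → ℕ → Maybe ℕ
firstFailure P? zero    i = nothing
firstFailure P? (suc f) i with P? i
... | yes _ = firstFailure P? f (suc i)
... | no  _ = just i

firstFailure-just : ∀ {P : ℕ → Set} (P? : Decidable P) f i {m} → firstFailure P? f i ≡ just m →
                    i ≤ m × m < i + f × ¬ P m × (∀ {j} → i ≤ j → j < m → P j)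
firstFailure-just P? zero    i ()
firstFailure-just P? (suc f) i eq with P? i
firstFailure-just P? (suc f) i refl | no ¬p =
  ℕP.≤-refl , ℕP.m<m+n i (s≤s z≤n) , ¬p , λ i≤j j<i → ⊥-elim (ℕP.<-irrefl refl (ℕP.≤-<-trans i≤j j<i))
firstFailure-just {P} P? (suc f) i {m} eq | yes p =
  let (i<m , m<end , ¬pm , below) = firstFailure-just P? f (suc i) eq
  in ℕP.<⇒≤ i<m , subst (m <_) (sym (ℕP.+-suc i f)) m<end , ¬pm , holds-below p below
  where
  holds-below : P i → (∀ {j} → suc i ≤ j → j < m → P j) → ∀ {j} → i ≤ j → j < m → P j
  holds-below p below {j} i≤j j<m with i ≟ℕ j
  ... | yes refl = p
  ... | no  i≢j  = below (ℕP.≤∧≢⇒< i≤j i≢j) j<m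

firstFailure-nothing : ∀ {P : ℕ → Set} (P? : Decidable P) f i → firstFailure P? f i ≡ nothing →
                       ∀ {j} → i ≤ j → j < i + f → P j
firstFailure-nothing P? zero i _ {j} i≤j j<i+0 =
  ⊥-elim (ℕP.<-irrefl refl (ℕP.≤-<-trans i≤j (subst (j <_) (ℕP.+-identityʳ i) j<i+0)))
firstFailure-nothing P? (suc f) i eq {j} i≤j j<end with P? i
firstFailure-nothing P? (suc f) i () i≤j j<end | no _
... | yes p with i ≟ℕ j
...   | yes refl = p
...   | no  i≢j  = firstFailure-nothing P? f (suc i) eq (ℕP.≤∧≢⇒< i≤j i≢j) (subst (j <_) (ℕP.+-suc i f) j<end)

firstFailure-all : ∀ {P : ℕ → Set} (P? : Decidable P) f i → (∀ {j} → i ≤ j → j < i + f → P j) →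
                   firstFailure P? f i ≡ nothing
firstFailure-all P? zero    i _ = refl
firstFailure-all P? (suc f) i all with P? i
... | yes _ = firstFailure-all P? f (suc i)
                (λ {j} i<j j<end → all (ℕP.<⇒≤ i<j) (subst (j <_) (sym (ℕP.+-suc i f)) j<end))
... | no ¬p = ⊥-elim (¬p (all ℕP.≤-refl (ℕP.m<m+n i (s≤s z≤n))))

firstFailure-transfer : ∀ {P Q : ℕ → Set} (P? : Decidable P) (Q? : Decidable Q) f i {m} →
                        firstFailure P? f i ≡ just m → (∀ {j} → i ≤ j → j < m → Q j) → ¬ Q m →
                        firstFailure Q? f i ≡ just m
firstFailure-transfer P? Q? f i {m} eq below ¬qm with firstFailure-just P? f i eq
... | (i≤m , m<end , _ , _) with firstFailure Q? f i in eq′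
...   | nothing = ⊥-elim (¬qm (firstFailure-nothing Q? f i eq′ i≤m m<end))
...   | just m′ with firstFailure-just Q? f i eq′
...     | (i≤m′ , _ , ¬qm′ , below′) with ℕP.<-cmp m′ m
...       | tri< m′<m _ _ = ⊥-elim (¬qm′ (below i≤m′ m′<m))
...       | tri≈ _ refl _ = refl
...       | tri> _ _ m<m′ = ⊥-elim (¬qm (below′ i≤m m<m′))

flipValue : ℕ → ℤ → ℤ
flipValue m x with ∣ x ∣ ≟ℕ m
... | yes _ = - x
... | no  _ = x

flip-hit : ∀ {m} x → ∣ x ∣ ≡ m → flipValue m x ≡ - x
flip-hit {m} x hit with ∣ x ∣ ≟ℕ m
... | yes _   = refl
... | no miss = ⊥-elim (miss hit)

flip-miss : ∀ {m} x → ∣ x ∣ ≢ m → flipValue m x ≡ x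
flip-miss {m} x miss with ∣ x ∣ ≟ℕ m
... | yes hit = ⊥-elim (miss hit)
... | no _    = refl

flip-abs : ∀ m x → ∣ flipValue m x ∣ ≡ ∣ x ∣
flip-abs m x with ∣ x ∣ ≟ℕ m
... | yes _ = ∣-i∣≡∣i∣ x
... | no  _ = refl

flip-involutive : ∀ m x → flipValue m (flipValue m x) ≡ x
flip-involutive m x with ∣ x ∣ ≟ℕ m
... | yes hit = trans (flip-hit (- x) (trans (∣-i∣≡∣i∣ x) hit)) (neg-involutive x)
... | no miss = flip-miss x miss

flip-zero : ∀ m → flipValue m 0ℤ ≡ 0ℤ
flip-zero m with 0 ≟ℕ m
... | yes _ = refl
... | no  _ = refl

PeakAt : ℕ → (ℕ → ℤ) → ℕ → Set
PeakAt n e i = 1 ≤ i × i ≤ n ∸ 1 × e (i ∸ 1) <ℤ e i × e (suc i) <ℤ e i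

record IsFirstNonCanonical (n : ℕ) (e : ℕ → ℤ) (m : ℕ) : Set where
  field
    signedPerm      : SignedPermFn n e
    1≤m             : 1 ≤ m
    m≤n             : m ≤ n
    canonical-below : ∀ {i} → 1 ≤ i → i < m → Canonical n e i
    non-canonical   : ¬ Canonical n e m

-- The sign-reversing step: negate the value m, where m is the first
-- non-canonical position of e.  This preserves the peak set and keeps m the
-- first non-canonical position.
module SignFlip {n e m} (H : IsFirstNonCanonical n e m) where
  open IsFirstNonCanonical H
  open SignedPermFn signedPerm

  e′ : ℕ → ℤ
  e′ k = flipValue m (e k)

  in-place : ∀ {i} → 1 ≤ i → i < m → ∣ e i ∣ ≡ i
  in-place 1≤i i<m = canonical-abs (canonical-below 1≤i i<m)

  no-m-below : ∀ {k} → 1 ≤ k → k < m → ∣ e k ∣ ≢ m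
  no-m-below 1≤k k<m hit = ℕP.<-irrefl (trans (sym (in-place 1≤k k<m)) hit) k<m

  small-value-in-place : ∀ {k} → k ≤ n → ∣ e k ∣ < m → k ≡ ∣ e k ∣
  small-value-in-place {zero}  _   _     = sym (cong ∣_∣ at-zero)
  small-value-in-place {suc k} k<n small =
    abs-injective (s≤s z≤n) k<n 1≤t (ℕP.<⇒≤ (ℕP.<-≤-trans small m≤n)) (sym (in-place 1≤t small))
    where 1≤t = nonzero (s≤s z≤n) k<n

  m-position-≥ : ∀ {k} → ∣ e k ∣ ≡ m → m ≤ k
  m-position-≥ {zero}  hit = ⊥-elim (ℕP.<-irrefl (trans (cong ∣_∣ (sym at-zero)) hit) 1≤m)
  m-position-≥ {suc k} hit = ℕP.≮⇒≥ λ k<m → no-m-below (s≤s z≤n) k<m hit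

  large-value-beyond : ∀ {k} → k ≤ n → m ≤ k → ∣ e k ∣ ≢ m → m < ∣ e k ∣
  large-value-beyond {k} k≤n m≤k miss with ℕP.<-cmp m ∣ e k ∣
  ... | tri< m< _ _ = m<
  ... | tri≈ _ m≡ _ = ⊥-elim (miss (sym m≡))
  ... | tri> _ _ >m = ⊥-elim (ℕP.<-irrefl (sym (small-value-in-place k≤n >m)) (ℕP.<-≤-trans >m m≤k))

  -- For even m the value at position m is not ±m: otherwise position m-1
  -- (odd, canonical) forces e m < 0, making m canonical.
  even⇒m-not-at-m : evenᵇ m ≡ true → ∣ e m ∣ ≢ m
  even⇒m-not-at-m = by-position m 1≤m canonical-below non-canonical
    where
    by-position : ∀ m → 1 ≤ m → (∀ {i} → 1 ≤ i → i < m → Canonical n e i) → ¬ Canonical n e m →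
                  evenᵇ m ≡ true → ∣ e m ∣ ≢ m
    by-position (suc zero)    _ _ _ () _
    by-position (suc (suc p)) _ below ¬canon ev hit =
      let (_ , _ , next<0) = Equivalence.to (canonical-odd (odd-before-even (suc p) ev)) (below (s≤s z≤n) ℕP.≤-refl)
      in ¬canon (Equivalence.from (canonical-even ev) (negative-of-abs _ next<0 hit))

  -- The flip changes no comparison between adjacent positions a and a+1,
  -- except possibly the pair (m-1, m) when |e m| = m: the entry ±m is
  -- compared with a neighbour of larger absolute value.
  AdjacentOrder : ℕ → Set
  AdjacentOrder a = (e a <ℤ e (suc a) ⇔ e′ a <ℤ e′ (suc a)) × (e (suc a) <ℤ e a ⇔ e′ (suc a) <ℤ e′ a)

  adjacent-order-preserved : ∀ {a} → a < n → ¬ (suc a ≡ m × ∣ e m ∣ ≡ m) → AdjacentOrder a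
  adjacent-order-preserved {a} a<n exceptional = by-cases (∣ e a ∣ ≟ℕ m) (∣ e (suc a) ∣ ≟ℕ m)
    where
    by-cases : Dec (∣ e a ∣ ≡ m) → Dec (∣ e (suc a) ∣ ≡ m) → AdjacentOrder a
    by-cases (yes hit) (yes hit′) =
      ⊥-elim (ℕP.1+n≢n (sym (abs-injective (ℕP.≤-trans 1≤m (m-position-≥ hit)) (ℕP.<⇒≤ a<n) (s≤s z≤n) a<n
                                            (trans hit (sym hit′)))))
    by-cases (yes hit) (no miss′)
      rewrite flip-hit (e a) hit | flip-miss (e (suc a)) miss′ =
      smaller-<ˡ-⇔ (e a) (e (suc a)) smaller , smaller-<ʳ-⇔ (e a) (e (suc a)) smaller
      where
      smaller : ∣ e a ∣ < ∣ e (suc a) ∣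
      smaller = subst (_< ∣ e (suc a) ∣) (sym hit)
        (large-value-beyond a<n (ℕP.m≤n⇒m≤1+n (m-position-≥ hit)) miss′)
    by-cases (no miss) (yes hit′)
      rewrite flip-miss (e a) miss | flip-hit (e (suc a)) hit′ =
      smaller-<ʳ-⇔ (e (suc a)) (e a) smaller , smaller-<ˡ-⇔ (e (suc a)) (e a) smaller
      where
      m<1+a : m < suc a
      m<1+a = ℕP.≤∧≢⇒< (m-position-≥ hit′) (λ m≡ → exceptional (sym m≡ , subst (λ k → ∣ e k ∣ ≡ m) (sym m≡) hit′))
      smaller : ∣ e (suc a) ∣ < ∣ e a ∣
      smaller = subst (_< ∣ e a ∣) (sym hit′) (large-value-beyond (ℕP.<⇒≤ a<n) (ℕ.s≤s⁻¹ m<1+a) miss)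
    by-cases (no miss) (no miss′)
      rewrite flip-miss (e a) miss | flip-miss (e (suc a)) miss′ =
      ⇔.refl , ⇔.refl

  -- In the exceptional case |e m| = m (so m is odd), neither e nor e′ has a
  -- peak at m: its right neighbour is non-negative (m is not canonical) and
  -- larger in absolute value ...
  no-peak-at-m : ∣ e m ∣ ≡ m → evenᵇ m ≡ false → ¬ PeakAt n e m × ¬ PeakAt n e′ m
  no-peak-at-m hit odd =
      (λ (_ , m≤n∸1 , _ , next<) → let m<n = <-of-≤∸1 1≤m m≤n∸1 in
         nonneg-not-below-smaller (e m) (e (suc m)) (next≥0 m<n) (bigger m<n) next<)
    , (λ (_ , m≤n∸1 , _ , next<) → let m<n = <-of-≤∸1 1≤m m≤n∸1 in
         nonneg-not-below-smaller (- e m) (e (suc m)) (next≥0 m<n)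
           (subst (_< ∣ e (suc m) ∣) (sym (∣-i∣≡∣i∣ (e m))) (bigger m<n))
           (subst₂ _<ℤ_ (flip-miss (e (suc m)) (next-miss m<n)) (flip-hit (e m) hit) next<))
    where
    next≥0 : m < n → ¬ (e (suc m) <ℤ 0ℤ)
    next≥0 m<n next<0 = non-canonical (Equivalence.from (canonical-odd odd) (hit , m<n , next<0))
    next-miss : m < n → ∣ e (suc m) ∣ ≢ m
    next-miss m<n h = ℕP.1+n≢n (abs-injective (s≤s z≤n) m<n 1≤m m≤n (trans h (sym hit)))
    bigger : m < n → ∣ e m ∣ < ∣ e (suc m) ∣
    bigger m<n = subst (_< ∣ e (suc m) ∣) (sym hit) (large-value-beyond m<n (ℕP.n≤1+n m) (next-miss m<n))

  -- ... and none at m-1 either: position m-1 is even and canonical, carrying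
  -- -(m-1), which is below its left neighbour; the flip does not touch it.
  no-peak-before-m : ∣ e m ∣ ≡ m → evenᵇ m ≡ false → ∀ i → suc i ≡ m → ¬ PeakAt n e i × ¬ PeakAt n e′ i
  no-peak-before-m hit odd zero          _     = (λ ()) , (λ ())
  no-peak-before-m hit ()  (suc zero)    refl
  no-peak-before-m hit odd (suc (suc j)) i+1≡m =
      (λ (_ , _ , prev< , _) → not-below-neg (e (suc j)) i prev-smaller (subst (e (suc j) <ℤ_) at-i prev<))
    , (λ (_ , _ , prev< , _) → not-below-neg (e (suc j)) i prev-smaller
         (subst (e (suc j) <ℤ_) at-i (subst₂ _<ℤ_ (flip-miss (e (suc j)) (no-m-below (s≤s z≤n) j+1<m))
                                                  (flip-miss (e i) (no-m-below (s≤s z≤n) i<m)) prev<)))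
    where
    i = suc (suc j)
    i<m : i < m
    i<m = subst (i <_) i+1≡m (ℕP.n<1+n i)
    j+1<m : suc j < m
    j+1<m = ℕP.<-trans (ℕP.n<1+n (suc j)) i<m
    even-i : evenᵇ i ≡ true
    even-i = even-before-odd i (trans (cong evenᵇ i+1≡m) odd)
    at-i : e i ≡ - (+ i)
    at-i = Equivalence.to (canonical-even even-i) (canonical-below (s≤s z≤n) i<m)
    prev-smaller : ∣ e (suc j) ∣ < i
    prev-smaller = subst (_< i) (sym (in-place (s≤s z≤n) j+1<m)) (ℕP.n<1+n (suc j))

  -- Hence the flip preserves every peak: at i the peak condition only compares
  -- the pairs (i-1, i) and (i, i+1).
  peaks-preserved : ∀ i → PeakAt n e i ⇔ PeakAt n e′ i
  peaks-preserved zero    = mk⇔ (λ ()) (λ ())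
  peaks-preserved (suc j) = by-cases (∣ e m ∣ ≟ℕ m)
    where
    neither : ∀ {P Q : Set} → ¬ P × ¬ Q → P ⇔ Q
    neither (¬p , ¬q) = mk⇔ (λ p → ⊥-elim (¬p p)) (λ q → ⊥-elim (¬q q))
    via-adjacent : ¬ (suc j ≡ m × ∣ e m ∣ ≡ m) → ¬ (suc (suc j) ≡ m × ∣ e m ∣ ≡ m) →
                   PeakAt n e (suc j) ⇔ PeakAt n e′ (suc j)
    via-adjacent ok-left ok-right = mk⇔
      (λ (1≤i , i≤ , left , right) → 1≤i , i≤ , Equivalence.to (proj₁ (left-pair 1≤i i≤)) left
                                                , Equivalence.to (proj₂ (right-pair 1≤i i≤)) right)
      (λ (1≤i , i≤ , left , right) → 1≤i , i≤ , Equivalence.from (proj₁ (left-pair 1≤i i≤)) left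
                                                , Equivalence.from (proj₂ (right-pair 1≤i i≤)) right)
      where
      right-pair : 1 ≤ suc j → suc j ≤ n ∸ 1 → AdjacentOrder (suc j)
      right-pair 1≤i i≤ = adjacent-order-preserved (<-of-≤∸1 1≤i i≤) ok-right
      left-pair : 1 ≤ suc j → suc j ≤ n ∸ 1 → AdjacentOrder j
      left-pair 1≤i i≤ = adjacent-order-preserved (ℕP.<-trans (ℕP.n<1+n j) (<-of-≤∸1 1≤i i≤)) ok-left
    by-cases : Dec (∣ e m ∣ ≡ m) → PeakAt n e (suc j) ⇔ PeakAt n e′ (suc j)
    by-cases (no moved) = via-adjacent (λ (_ , hit) → moved hit) (λ (_ , hit) → moved hit)
    by-cases (yes hit) with evenᵇ m in parity | suc j ≟ℕ m | suc (suc j) ≟ℕ m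
    ... | true  | _        | _        = ⊥-elim (even⇒m-not-at-m parity hit)
    ... | false | yes refl | _        = neither (no-peak-at-m hit parity)
    ... | false | no _     | yes i+1≡m = neither (no-peak-before-m hit parity (suc j) i+1≡m)
    ... | false | no i≢m   | no i+1≢m = via-adjacent (λ (eq , _) → i≢m eq) (λ (eq , _) → i+1≢m eq)

  canonical-below′ : ∀ {i} → 1 ≤ i → i < m → Canonical n e′ i
  canonical-below′ {i} 1≤i i<m = by-parity (evenᵇ i) refl
    where
    by-parity : ∀ b → evenᵇ i ≡ b → Canonical n e′ i
    by-parity true  ev = Equivalence.from (canonical-even ev)
      (trans (flip-miss (e i) (no-m-below 1≤i i<m)) (Equivalence.to (canonical-even ev) (canonical-below 1≤i i<m)))
    by-parity false od =
      let (abs , i<n , next<0) = Equivalence.to (canonical-odd od) (canonical-below 1≤i i<m)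
      in Equivalence.from (canonical-odd od)
           (trans (flip-abs m (e i)) abs , i<n , subst (_<ℤ 0ℤ) (sym (flip-miss (e (suc i)) next-miss)) next<0)
      where
      -- below m position i+1 carries ±(i+1); if i+1 = m, then m is even
      next-miss : ∣ e (suc i) ∣ ≢ m
      next-miss hit with suc i ≟ℕ m
      ... | yes refl = even⇒m-not-at-m (even-after-odd i od) hit
      ... | no i+1≢m = no-m-below (s≤s z≤n) (ℕP.≤∧≢⇒< i<m i+1≢m) hit

  non-canonical′ : ¬ Canonical n e′ m
  non-canonical′ canon′ = by-parity (evenᵇ m) refl
    where
    by-parity : ∀ b → evenᵇ m ≡ b → ⊥
    by-parity true  ev = non-canonical (Equivalence.from (canonical-even ev)
      (trans (sym (flip-miss (e m) (even⇒m-not-at-m ev))) (Equivalence.to (canonical-even ev) canon′)))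
    by-parity false od =
      let (abs′ , m<n , next<0) = Equivalence.to (canonical-odd od) canon′
          abs = trans (sym (flip-abs m (e m))) abs′
          next-miss : ∣ e (suc m) ∣ ≢ m
          next-miss h = ℕP.1+n≢n (abs-injective (s≤s z≤n) m<n 1≤m m≤n (trans h (sym abs)))
      in non-canonical (Equivalence.from (canonical-odd od)
           (abs , m<n , subst (_<ℤ 0ℤ) (flip-miss (e (suc m)) next-miss) next<0))

firstNonCanonical : ∀ {n} → Vec ℤ n → Maybe ℕ
firstNonCanonical {n} π = firstFailure (canonical? n (entry π)) n 1

flipAt : ∀ {n} → Maybe ℕ → Vec ℤ n → Vec ℤ n
flipAt nothing  π = π
flipAt (just m) π = map (flipValue m) π

φ : ∀ {n} → Vec ℤ n → Vec ℤ n
φ π = flipAt (firstNonCanonical π) π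

peakAt-cong : ∀ n {e e′} → (∀ k → e k ≡ e′ k) → ∀ {i} → PeakAt n e i → PeakAt n e′ i
peakAt-cong n same {i} (1≤i , i≤ , left , right) =
  1≤i , i≤ , subst₂ _<ℤ_ (same (i ∸ 1)) (same i) left , subst₂ _<ℤ_ (same (suc i)) (same i) right

module FlipVector {n} (π : Vec ℤ n) (isp : IsSignedPerm n π) {m} (first : firstNonCanonical π ≡ just m) where
  e : ℕ → ℤ
  e = entry π

  H : IsFirstNonCanonical n e m
  H = let (1≤m , m<1+n , ¬canon , below) = firstFailure-just (canonical? n e) n 1 first
      in record { signedPerm = signedPermFn isp ; 1≤m = 1≤m ; m≤n = ℕ.s≤s⁻¹ m<1+n
                ; canonical-below = below ; non-canonical = ¬canon }

  open SignFlip H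

  π′ : Vec ℤ n
  π′ = map (flipValue m) π

  entry-π′ : ∀ k → entry π′ k ≡ e′ k
  entry-π′ = entry-map (flipValue m) (flip-zero m) π

  signedPerm-π′ : IsSignedPerm n π′
  signedPerm-π′ =
      (λ j → subst (λ z → 1 ≤ z × z ≤ n) (sym (abs-π′ j)) (proj₁ isp j))
    , (λ t 1≤t t≤n → let (j , eq) = proj₂ isp t 1≤t t≤n in j , trans (abs-π′ j) eq)
    where
    abs-π′ : ∀ j → ∣ lookup π′ j ∣ ≡ ∣ lookup π j ∣
    abs-π′ j = trans (cong ∣_∣ (lookup-map j (flipValue m) π)) (flip-abs m (lookup π j))

  peaks-π′ : ∀ i → IsPeak n π′ i ⇔ IsPeak n π i
  peaks-π′ i = mk⇔ (λ pk → Equivalence.from (peaks-preserved i) (peakAt-cong n entry-π′ pk))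
                   (λ pk → peakAt-cong n (λ k → sym (entry-π′ k)) (Equivalence.to (peaks-preserved i) pk))

  -- ... and the same first non-canonical position m, so φ flips m back.
  first-π′ : firstNonCanonical π′ ≡ just m
  first-π′ = firstFailure-transfer (canonical? n e) (canonical? n (entry π′)) n 1 first
    (λ 1≤i i<m → canonical-cong (λ k → sym (entry-π′ k)) (canonical-below′ 1≤i i<m))
    (λ canon → non-canonical′ (canonical-cong entry-π′ canon))

  φ-π′ : φ π′ ≡ π
  φ-π′ rewrite first-π′ = begin
    map (flipValue m) (map (flipValue m) π)   ≡⟨ map-∘ (flipValue m) (flipValue m) π ⟨
    map (flipValue m ∘ flipValue m) π         ≡⟨ map-cong (flip-involutive m) π ⟩
    map id π                                  ≡⟨ map-id π ⟩
    π                                         ∎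
    where open ≡-Reasoning

  π′-moved : π′ ≢ π
  π′-moved π′≡π =
    let (k , _ , _ , hit) = value-position isp (IsFirstNonCanonical.1≤m H) (IsFirstNonCanonical.m≤n H)
        neg-fixed : - e k ≡ e k
        neg-fixed = trans (sym (flip-hit (e k) hit)) (trans (sym (entry-π′ k)) (cong (λ v → entry v k) π′≡π))
    in ℕP.<-irrefl (sym (trans (sym hit) (neg-fixed⇒abs-zero (e k) neg-fixed))) (IsFirstNonCanonical.1≤m H)

AllCanonical : ℕ → (ℕ → ℤ) → Set
AllCanonical n e = ∀ {i} → 1 ≤ i → i ≤ n → Canonical n e i

module _ {n} {π : Vec ℤ n} (isp : IsSignedPerm n π) where

  φ-signedPerm : IsSignedPerm n (φ π)
  φ-signedPerm with firstNonCanonical π in first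
  ... | nothing = isp
  ... | just m  = FlipVector.signedPerm-π′ π isp first

  φ-peaks : ∀ i → IsPeak n (φ π) i ⇔ IsPeak n π i
  φ-peaks i with firstNonCanonical π in first
  ... | nothing = ⇔.refl
  ... | just m  = FlipVector.peaks-π′ π isp first i

  φ-involutive : φ (φ π) ≡ π
  φ-involutive with firstNonCanonical π in first
  ... | nothing rewrite first = refl
  ... | just m  = FlipVector.φ-π′ π isp first

  fixed⇒canonical : φ π ≡ π → AllCanonical n (entry π)
  fixed⇒canonical fixed with firstNonCanonical π in first
  ... | nothing = λ 1≤i i≤n → firstFailure-nothing (canonical? n (entry π)) n 1 first 1≤i (s≤s i≤n)
  ... | just m  = ⊥-elim (FlipVector.π′-moved π isp first fixed)

canonical⇒fixed : ∀ {n} (π : Vec ℤ n) → AllCanonical n (entry π) → φ π ≡ π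
canonical⇒fixed {n} π canon
  rewrite firstFailure-all (canonical? n (entry π)) n 1 (λ 1≤i i<1+n → canon 1≤i (ℕ.s≤s⁻¹ i<1+n)) = refl

φ-InPB : ∀ {S n} {π : Vec ℤ n} → InPB S n π → InPB S n (φ π)
φ-InPB (isp , peaks) = φ-signedPerm isp , λ i → ⇔.trans (φ-peaks isp i) (peaks i)

-- An odd position must be followed by a position inside the word, so a
-- word of odd length is never canonical.
odd-length-not-canonical : ∀ {n e} → evenᵇ n ≡ false → ¬ AllCanonical n e
odd-length-not-canonical {zero}  () _
odd-length-not-canonical {suc n} od canon =
  ℕP.<-irrefl refl (proj₁ (proj₂ (Equivalence.to (canonical-odd od) (canon (s≤s z≤n) ℕP.≤-refl))))

module CanonicalPeaks {n e} (at-zero : e 0 ≡ 0ℤ) (canon : AllCanonical n e) where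

  abs-identity : ∀ {j} → j ≤ n → ∣ e j ∣ ≡ j
  abs-identity {zero}  _   = cong ∣_∣ at-zero
  abs-identity {suc j} j<n = canonical-abs (canon (s≤s z≤n) j<n)

  left-smaller : ∀ {j} → suc j ≤ n → ∣ e j ∣ < suc j
  left-smaller {j} j<n = subst (_< suc j) (sym (abs-identity (ℕP.<⇒≤ j<n))) (ℕP.n<1+n j)

  -- an even position s carries -s, below its left neighbour ±(s-1)
  no-even-peak : ∀ {s} → evenᵇ s ≡ true → ¬ PeakAt n e s
  no-even-peak {suc j} ev (1≤s , s≤ , left< , _) =
    let s<n = <-of-≤∸1 1≤s s≤
        at-s = Equivalence.to (canonical-even ev) (canon 1≤s (ℕP.<⇒≤ s<n))
    in not-below-neg (e j) (suc j) (left-smaller (ℕP.<⇒≤ s<n)) (subst (e j <ℤ_) at-s left<)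

  -- an odd position i < n is above its neighbours ±(i-1) and -(i+1) iff π_i = +i
  odd-peak⇔positive : ∀ {i} → evenᵇ i ≡ false → i < n → PeakAt n e i ⇔ (0ℤ <ℤ e i)
  odd-peak⇔positive {suc j} od i<n = mk⇔ to from
    where
    i = suc j
    at-next : e (suc i) ≡ - (+ suc i)
    at-next = Equivalence.to (canonical-even (even-after-odd i od)) (canon (s≤s z≤n) i<n)
    to : PeakAt n e i → 0ℤ <ℤ e i
    to (_ , _ , left< , _) with e i | abs-identity (ℕP.<⇒≤ i<n)
    ... | + _      | refl = +<+ (s≤s z≤n)
    ... | -[1+ a ] | refl = ⊥-elim (not-below-neg (e j) i (left-smaller (ℕP.<⇒≤ i<n)) left<)
    from : 0ℤ <ℤ e i → PeakAt n e i
    from positive with e i | abs-identity (ℕP.<⇒≤ i<n)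
    ... | + _ | refl = s≤s z≤n , ℕP.<⇒≤pred i<n
                     , below-abs (e j) (left-smaller (ℕP.<⇒≤ i<n))
                     , subst (_<ℤ + i) (sym at-next) -<+

-- A canonical word of even length is determined by its peak set: even
-- positions are forced, and an odd position i carries +i exactly at a peak.
canonical-determined-by-peaks : ∀ {n e₁ e₂} → evenᵇ n ≡ true → e₁ 0 ≡ 0ℤ → e₂ 0 ≡ 0ℤ →
  AllCanonical n e₁ → AllCanonical n e₂ → (∀ i → PeakAt n e₁ i ⇔ PeakAt n e₂ i) →
  ∀ {i} → 1 ≤ i → i ≤ n → e₁ i ≡ e₂ i
canonical-determined-by-peaks {n} {e₁} {e₂} ev-n zero₁ zero₂ canon₁ canon₂ same-peaks {i} 1≤i i≤n =
  by-parity (evenᵇ i) refl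
  where
  module C₁ = CanonicalPeaks zero₁ canon₁
  module C₂ = CanonicalPeaks zero₂ canon₂
  by-parity : ∀ b → evenᵇ i ≡ b → e₁ i ≡ e₂ i
  by-parity true ev = trans (Equivalence.to (canonical-even ev) (canon₁ 1≤i i≤n))
                            (sym (Equivalence.to (canonical-even ev) (canon₂ 1≤i i≤n)))
  by-parity false od = same-abs-same-sign (e₁ i) (e₂ i)
    (trans (C₁.abs-identity i≤n) (sym (C₂.abs-identity i≤n)))
    (⇔.trans (⇔.sym (C₁.odd-peak⇔positive od i<n)) (⇔.trans (same-peaks i) (C₂.odd-peak⇔positive od i<n)))
    where i<n = odd-<-even i≤n od ev-n

module CanonicalWitness (n : ℕ) (S : List ℕ) (ev-n : evenᵇ n ≡ true)
                        (S-odd : All IsOdd S) (S-below : ∀ {i} → i ∈ S → i < n) where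

  signed : ℕ → ℤ
  signed i with i ∈? S
  ... | yes _ = + i
  ... | no  _ = - (+ i)

  signed-in : ∀ {i} → i ∈ S → signed i ≡ + i
  signed-in {i} i∈S with i ∈? S
  ... | yes _   = refl
  ... | no  i∉S = ⊥-elim (i∉S i∈S)

  signed-out : ∀ {i} → ¬ i ∈ S → signed i ≡ - (+ i)
  signed-out {i} i∉S with i ∈? S
  ... | yes i∈S = ⊥-elim (i∉S i∈S)
  ... | no  _   = refl

  signed-abs : ∀ i → ∣ signed i ∣ ≡ i
  signed-abs i with i ∈? S
  ... | yes _ = refl
  ... | no  _ = ∣-i∣≡∣i∣ (+ i)

  even-out : ∀ {i} → evenᵇ i ≡ true → ¬ i ∈ S
  even-out {i} ev i∈S = parity-distinct i i (IsOdd⇒evenᵇ i (All.lookup S-odd i∈S)) ev refl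

  witness : Vec ℤ n
  witness = tabulate (λ j → signed (suc (toℕ j)))

  entry-witness : ∀ {i} → 1 ≤ i → i ≤ n → entry witness i ≡ signed i
  entry-witness {suc i} _ i<n = trans (entry-< witness i i<n)
    (trans (lookup∘tabulate _ (fromℕ< i<n)) (cong (λ k → signed (suc k)) (FinP.toℕ-fromℕ< i<n)))

  witness-signedPerm : IsSignedPerm n witness
  witness-signedPerm =
      (λ j → subst (λ z → 1 ≤ z × z ≤ n) (sym (abs-lookup j)) (s≤s z≤n , FinP.toℕ<n j))
    , λ { (suc t) _ t<n → fromℕ< t<n , trans (abs-lookup (fromℕ< t<n)) (cong suc (FinP.toℕ-fromℕ< t<n)) }
    where
    abs-lookup : ∀ j → ∣ lookup witness j ∣ ≡ suc (toℕ j)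
    abs-lookup j = trans (cong ∣_∣ (lookup∘tabulate _ j)) (signed-abs _)

  witness-canonical : AllCanonical n (entry witness)
  witness-canonical {i} 1≤i i≤n = by-parity (evenᵇ i) refl
    where
    by-parity : ∀ b → evenᵇ i ≡ b → Canonical n (entry witness) i
    by-parity true ev = Equivalence.from (canonical-even ev)
      (trans (entry-witness 1≤i i≤n) (signed-out (even-out ev)))
    by-parity false od = Equivalence.from (canonical-odd od)
      ( trans (cong ∣_∣ (entry-witness 1≤i i≤n)) (signed-abs i)
      , i<n
      , subst (_<ℤ 0ℤ) (sym (trans (entry-witness (s≤s z≤n) i<n) (signed-out (even-out (even-after-odd i od))))) -<+ )
      where i<n = odd-<-even i≤n od ev-n

  module W = CanonicalPeaks {e = entry witness} refl witness-canonical

  witness-peaks : PeakSetIs n witness S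
  witness-peaks i = mk⇔ to from
    where
    to : IsPeak n witness i → i ∈ S
    to peak with evenᵇ i in parity | i ∈? S
    ... | true  | _       = ⊥-elim (W.no-even-peak parity peak)
    ... | false | yes i∈S = i∈S
    ... | false | no  i∉S = ⊥-elim (neg-not-positive i (subst (0ℤ <ℤ_) at-i positive))
      where
      positive = Equivalence.to (W.odd-peak⇔positive parity (peak-< peak)) peak
      at-i = trans (entry-witness (proj₁ peak) (ℕP.<⇒≤ (peak-< peak))) (signed-out i∉S)
    from : i ∈ S → IsPeak n witness i
    from i∈S = Equivalence.from (W.odd-peak⇔positive od i<n)
      (subst (0ℤ <ℤ_) (sym (trans (entry-witness 1≤i (ℕP.<⇒≤ i<n)) (signed-in i∈S))) positive)
      where
      od = IsOdd⇒evenᵇ i (All.lookup S-odd i∈S)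
      i<n = S-below i∈S
      1≤i = odd-positive i od
      positive : 0ℤ <ℤ + i
      positive = +<+ 1≤i

module Counting {S n} (members : List (Vec ℤ n)) (unique : Unique members)
                (membership : ∀ π → π ∈ members ⇔ InPB S n π) where
  open InvolutionParity (≡-dec _≟ℤ_) (φ {n})

  in-PB : ∀ {π} → π ∈ members → InPB S n π
  in-PB {π} = Equivalence.to (membership π)

  parity : length members % 2 ≡ length (filter fixed? members) % 2
  parity = parity-of-fixed-points members unique
    (λ {π} m → Equivalence.from (membership (φ π)) (φ-InPB (in-PB m)))
    (λ m → φ-involutive (proj₁ (in-PB m)))

  fixed-canonical : ∀ {π} → π ∈ filter fixed? members → InPB S n π × AllCanonical n (entry π)
  fixed-canonical m = let (π∈ , fixed) = ∈-filter⁻ fixed? {xs = members} m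
                      in in-PB π∈ , fixed⇒canonical (proj₁ (in-PB π∈)) fixed

  none-fixed : (∀ {π} → InPB S n π → ¬ AllCanonical n (entry π)) → length (filter fixed? members) ≡ 0
  none-fixed none = cong length (filter-none fixed? {xs = members}
    (All.tabulate λ m fixed → let (inPB , canon) = fixed-canonical (∈-filter⁺ fixed? m fixed) in none inPB canon))

  one-fixed : ∀ c → InPB S n c → AllCanonical n (entry c) →
              (∀ {π} → InPB S n π → AllCanonical n (entry π) → π ≡ c) → length (filter fixed? members) ≡ 1
  one-fixed c c-in c-canon only = length-singleton (Unique.filter⁺ fixed? unique)
    (∈-filter⁺ fixed? (Equivalence.from (membership c) c-in) (canonical⇒fixed c c-canon))
    (λ m → let (inPB , canon) = fixed-canonical m in only inPB canon)

-- If S contains an even position or n is odd, no member of P̂_B(S,n) is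
-- canonical: an even element of S would be a peak at an even position, and a
-- canonical word has even length.
no-canonical-member : ∀ {S n} {π : Vec ℤ n} → Any IsEven S ⊎ IsOdd n → InPB S n π → ¬ AllCanonical n (entry π)
no-canonical-member {n = n} (inj₂ n-odd) _ = odd-length-not-canonical (IsOdd⇒evenᵇ n n-odd)
no-canonical-member (inj₁ some-even) (_ , peaks) canon =
  let (s , s∈S , s-even) = find some-even
  in CanonicalPeaks.no-even-peak refl canon (IsEven⇒evenᵇ s s-even) (Equivalence.from (peaks s) s∈S)

unique-canonical-member : ∀ {S n} → All IsOdd S → IsEven n → Admissible S n →
  ∃[ c ] (InPB S n c × AllCanonical n (entry c) × (∀ {π} → InPB S n π → AllCanonical n (entry π) → π ≡ c))
unique-canonical-member {S} {n} S-odd n-even (_ , _ , peaks₀) =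
  witness , (witness-signedPerm , witness-peaks) , witness-canonical ,
  λ (_ , peaks) canon → entries-determine _ _
    (canonical-determined-by-peaks ev-n refl refl canon witness-canonical
       (λ i → ⇔.trans (peaks i) (⇔.sym (witness-peaks i))))
  where
  ev-n = IsEven⇒evenᵇ n n-even
  open CanonicalWitness n S ev-n S-odd (λ {i} i∈S → peak-< (Equivalence.from (peaks₀ i) i∈S))

theorem3p4 : (n : ℕ) (S : List ℕ) → Admissible S n →
    ∃[ k ] (HasCard (InPB S n) k
    × ((Any IsEven S ⊎ IsOdd n → IsEven k)
    × (All IsOdd S × IsEven n → IsOdd k)))
theorem3p4 n S admissible with card-PB S n
... | k , card@(members , unique , membership , refl) = k , card , even-case , odd-case
  where
  open Counting members unique membership
  even-case : Any IsEven S ⊎ IsOdd n → IsEven k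
  even-case h = trans parity (cong (_% 2) (none-fixed (no-canonical-member h)))
  odd-case : All IsOdd S × IsEven n → IsOdd k
  odd-case (S-odd , n-even) =
    let (c , c-in , c-canon , only) = unique-canonical-member S-odd n-even admissible
    in trans parity (cong (_% 2) (one-fixed c c-in c-canon only))
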